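{- Let $G$ be a finite, simple, connected graph of order $n$ which is randomly $k$-dimensional, and suppose $G\neq K_n$. Then $\Delta(G)\leq n-2$, where $\Delta(G)$ is the maximum degree of $G$.
   Context: $d(x,y)$ is the distance in $G$. For an ordered set $W=\{w_1,\ldots,w_k\}\subseteq V(G)$ and $v\in V(G)$, $r(v|W)=(d(v,w_1),\ldots,d(v,w_k))$. $W$ is a resolving set if distinct vertices have distinct representations with respect to $W$. The metric dimension $\beta(G)$ is the minimum size of a resolving set; a resolving set of size $\beta(G)$ is a basis. $G$ is randomly $k$-dimensional if $\beta(G)=k$ and every $k$-subset of $V(G)$ is a basis of $G$. -}

module Defs where

open import Data.Nat using (ℕ; zero; suc; _≤_)
open import Data.Bool using (Bool; true; false)
open import Data.Fin using (Fin)
open import Data.Fin.Subset using (Subset; _∈_; ∣_∣)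
open import Data.Vec using (tabulate)
open import Data.Product using (Σ; _×_; ∃)
open import Relation.Binary.PropositionalEquality using (_≡_)
open import Relation.Nullary using (¬_)

record Graph (n : ℕ) : Set where
  field
    adj     : Fin n → Fin n → Bool
    adj-sym : ∀ x y → adj x y ≡ adj y x
    adj-irr : ∀ x → adj x x ≡ false

module _ {n : ℕ} (G : Graph n) where
  open Graph G

  Edge : Fin n → Fin n → Set
  Edge x y = adj x y ≡ true

  data Walk : Fin n → Fin n → ℕ → Set where
    nil  : ∀ {x} → Walk x x zero
    cons : ∀ {x y z m} → Edge x y → Walk y z m → Walk x z (suc m)

  Connected : Set
  Connected = ∀ x y → ∃ λ m → Walk x y m

  Dist : Fin n → Fin n → ℕ → Set
  Dist x y m = Walk x y m × (∀ m' → Walk x y m' → m ≤ m')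

  Resolving : Subset n → Set
  Resolving W = ∀ x y →
    (∀ w → w ∈ W → ∀ a b → Dist x w a → Dist y w b → a ≡ b) → x ≡ y

  MetricDim : ℕ → Set
  MetricDim k = (Σ (Subset n) λ W → Resolving W × ∣ W ∣ ≡ k)
              × (∀ W → Resolving W → k ≤ ∣ W ∣)

  Basis : Subset n → Set
  Basis W = Resolving W × (∀ k → MetricDim k → ∣ W ∣ ≡ k)

  RandomlyDim : ℕ → Set
  RandomlyDim k = MetricDim k × (∀ W → ∣ W ∣ ≡ k → Basis W)

  Complete : Set
  Complete = ∀ x y → ¬ (x ≡ y) → Edge x y

  degree : Fin n → ℕ
  degree v = ∣ tabulate (adj v) ∣

  MaxDegree≤ : ℕ → Set
  MaxDegree≤ d = ∀ v → degree v ≤ d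

-- Suppose some vertex v had degree n - 1. Then every distance is 0, 1 or 2 and is determined by
-- adjacency. For a (k-1)-set T avoiding v,
-- T does not resolve G while T ∪ {z} does for every z ∉ T; so the pair left unresolved by T is v
-- and a vertex u whose neighbourhood outside v is exactly T. Applying this to T - t ∪ {u} shows that
-- the neighbourhood of each t ∈ T outside v is T - t ∪ {u}, so T ∪ {u} is a clique. As G is not
-- complete, some b lies outside T ∪ {u, v}, and then the k-set T - t ∪ {v, b} fails to separate
-- t from u. The cases k ≤ 1 fail on ∅ and {v} directly.
module Submission where

open import Defs
open import Data.Nat using (ℕ; zero; suc; _∸_; _≤_; z≤n; s≤s; _≤?_) renaming (_≟_ to _≟ℕ_)
open import Data.Nat.Properties using (suc-injective; ≤-trans; ≤-antisym; ≤-reflexive; 1+n≰n)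
open import Data.Bool using (true; false; if_then_else_)
open import Data.Bool.Properties using (¬-not) renaming (_≟_ to _≟ᵇ_)
open import Data.Fin using (Fin; zero; suc)
open import Data.Fin.Properties using (_≟_; all?; ¬∀⟶∃¬)
open import Data.Fin.Subset using (Subset; inside; outside; _∈_; _∉_; _∪_; _-_; ⁅_⁆; ⊥; ⊤; ∣_∣; Nonempty)
open import Data.Fin.Subset.Properties
open import Data.Vec using (_∷_; here; there; tabulate)
open import Data.Vec.Properties using ([]=⇒lookup; lookup∘tabulate)
open import Data.Product using (∃; ∃₂; _×_; _,_; proj₁; proj₂)
open import Data.Sum using (_⊎_; inj₁; inj₂; [_,_]′; map₂)
open import Data.Empty using () renaming (⊥ to ⊥₀)
open import Function using (_∘_)
open import Relation.Nullary using (¬_; Dec; yes; no; ¬?; contradiction)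
open import Relation.Nullary.Decidable using (_→-dec_; decidable-stable)
open import Relation.Binary.PropositionalEquality

private variable n m : ℕ

x∉p-x : ∀ (p : Subset n) x → x ∉ p - x
x∉p-x (s ∷ p) zero ()
x∉p-x (s ∷ p) (suc x) (there x∈p-x) = x∉p-x p x x∈p-x

x∈p-y⇒x∈p : ∀ {p : Subset n} {x y} → x ∈ p - y → x ∈ p
x∈p-y⇒x∈p {p = p} {y = y} = p─q⊆p p ⁅ y ⁆

x∈p∪⁅y⁆⁻ : ∀ {p : Subset n} {x y} → x ∈ p ∪ ⁅ y ⁆ → x ∈ p ⊎ x ≡ y
x∈p∪⁅y⁆⁻ {p = p} {y = y} = map₂ (x∈⁅y⁆⇒x≡y y) ∘ x∈p∪q⁻ p ⁅ y ⁆

x∉p∧x≢y⇒x∉p∪⁅y⁆ : ∀ {p : Subset n} {x y} → x ∉ p → x ≢ y → x ∉ p ∪ ⁅ y ⁆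
x∉p∧x≢y⇒x∉p∪⁅y⁆ x∉p x≢y = [ x∉p , x≢y ]′ ∘ x∈p∪⁅y⁆⁻

x∉p⇒x∉p-y : ∀ {p : Subset n} {x y} → x ∉ p → x ∉ p - y
x∉p⇒x∉p-y x∉p = x∉p ∘ x∈p-y⇒x∈p

x∈p⇒x∈p∪⁅y⁆ : ∀ {p : Subset n} {x y} → x ∈ p → x ∈ p ∪ ⁅ y ⁆
x∈p⇒x∈p∪⁅y⁆ = x∈p∪q⁺ ∘ inj₁

y∈p∪⁅y⁆ : ∀ {p : Subset n} y → y ∈ p ∪ ⁅ y ⁆
y∈p∪⁅y⁆ y = x∈p∪q⁺ (inj₂ (x∈⁅x⁆ y))

x∉p∪⁅y⁆⇒x≢y : ∀ {p : Subset n} {x y} → x ∉ p ∪ ⁅ y ⁆ → x ≢ y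
x∉p∪⁅y⁆⇒x≢y x∉ refl = x∉ (y∈p∪⁅y⁆ _)

x∈p⇒suc∣p-x∣≡∣p∣ : ∀ (p : Subset n) {x} → x ∈ p → suc ∣ p - x ∣ ≡ ∣ p ∣
x∈p⇒suc∣p-x∣≡∣p∣ (inside ∷ p) here = cong (suc ∘ ∣_∣) (p─⊥≡p p)
x∈p⇒suc∣p-x∣≡∣p∣ (inside ∷ p) (there x∈p) = cong suc (x∈p⇒suc∣p-x∣≡∣p∣ p x∈p)
x∈p⇒suc∣p-x∣≡∣p∣ (outside ∷ p) (there x∈p) = x∈p⇒suc∣p-x∣≡∣p∣ p x∈p

x∉p⇒∣p∪⁅x⁆∣≡suc∣p∣ : ∀ {p : Subset n} {x} → x ∉ p → ∣ p ∪ ⁅ x ⁆ ∣ ≡ suc ∣ p ∣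
x∉p⇒∣p∪⁅x⁆∣≡suc∣p∣ {p = inside ∷ p} {zero} x∉p = contradiction here x∉p
x∉p⇒∣p∪⁅x⁆∣≡suc∣p∣ {p = outside ∷ p} {zero} x∉p = cong (suc ∘ ∣_∣) (∪-identityʳ p)
x∉p⇒∣p∪⁅x⁆∣≡suc∣p∣ {p = inside ∷ p} {suc x} x∉p = cong suc (x∉p⇒∣p∪⁅x⁆∣≡suc∣p∣ (x∉p ∘ there))
x∉p⇒∣p∪⁅x⁆∣≡suc∣p∣ {p = outside ∷ p} {suc x} x∉p = x∉p⇒∣p∪⁅x⁆∣≡suc∣p∣ (x∉p ∘ there)

∣p∣≡suc⇒Nonempty : ∀ {p : Subset n} → ∣ p ∣ ≡ suc m → Nonempty p
∣p∣≡suc⇒Nonempty {n} {p = p} ∣p∣≡1+m with nonempty? p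
... | yes ne = ne
... | no ¬ne with () ← trans (sym (trans (cong ∣_∣ (Empty-unique ¬ne)) (∣⊥∣≡0 n))) ∣p∣≡1+m

∃p-x∌y : ∀ (p : Subset n) y → ∣ p ∣ ≡ suc m → ∃ λ q → suc ∣ q ∣ ≡ ∣ p ∣ × y ∉ q
∃p-x∌y p y ∣p∣≡1+m with y ∈? p
... | yes y∈p = p - y , x∈p⇒suc∣p-x∣≡∣p∣ p y∈p , x∉p-x p y
... | no y∉p with ∣p∣≡suc⇒Nonempty ∣p∣≡1+m
... | x , x∈p = p - x , x∈p⇒suc∣p-x∣≡∣p∣ p x∈p , y∉p ∘ x∈p-y⇒x∈p

¬∀₂⟶∃₂¬ : ∀ (P : Fin n → Fin n → Set) → (∀ x y → Dec (P x y)) → ¬ (∀ x y → P x y) → ∃₂ λ x y → ¬ P x y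
¬∀₂⟶∃₂¬ {n} P P? ¬∀P with ¬∀⟶∃¬ n (λ x → ∀ y → P x y) (λ x → all? (P? x)) ¬∀P
... | x , ¬∀Px with ¬∀⟶∃¬ n (P x) (P? x) ¬∀Px
... | y , ¬Pxy = x , y , ¬Pxy

module _ (G : Graph n) where
  open Graph G

  Edge⇒≢ : ∀ {x y} → Edge G x y → x ≢ y
  Edge⇒≢ {x} e refl with () ← trans (sym e) (adj-irr x)

  Edge-sym : ∀ {x y} → Edge G x y → Edge G y x
  Edge-sym {x} {y} e = trans (adj-sym y x) e

  ∃non-edge : ¬ Complete G → ∃₂ λ x y → x ≢ y × ¬ Edge G x y
  ∃non-edge ¬complete
    with ¬∀₂⟶∃₂¬ (λ x y → x ≢ y → Edge G x y) (λ x y → ¬? (x ≟ y) →-dec (adj x y ≟ᵇ true)) ¬complete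
  ... | x , y , ¬[x≢y→xy] = x , y , (λ x≡y → ¬[x≢y→xy] (contradiction x≡y)) , ¬[x≢y→xy] ∘ λ xy _ → xy

  degree≤n∸2 : ∀ {v z} → z ≢ v → ¬ Edge G v z → degree G v ≤ n ∸ 2
  degree≤n∸2 {v} {z} z≢v ¬vz = ≤-trans (p⊆q⇒∣p∣≤∣q∣ neighbours⊆) (≤-reflexive (cong (_∸ 2) size))
    where
    neighbours⊆ : ∀ {x} → x ∈ tabulate (adj v) → x ∈ ⊤ - v - z
    neighbours⊆ {x} x∈N = x∈p∧x≢y⇒x∈p-y (x∈p∧x≢y⇒x∈p-y ∈⊤ (Edge⇒≢ vx ∘ sym)) λ { refl → ¬vz vx }
      where
      vx : Edge G v x
      vx = trans (sym (lookup∘tabulate (adj v) x)) ([]=⇒lookup x∈N)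
    size : suc (suc ∣ ⊤ - v - z ∣) ≡ n
    size = trans (cong suc (x∈p⇒suc∣p-x∣≡∣p∣ (⊤ - v) (x∈p∧x≢y⇒x∈p-y ∈⊤ z≢v)))
                 (trans (x∈p⇒suc∣p-x∣≡∣p∣ ⊤ (∈⊤ {x = v})) (∣⊤∣≡n n))

  ¬degree≤n∸2⇒universal : ∀ {v} → ¬ degree G v ≤ n ∸ 2 → ∀ {z} → z ≢ v → Edge G v z
  ¬degree≤n∸2⇒universal {v} deg≰ {z} z≢v = decidable-stable (adj v z ≟ᵇ true) (deg≰ ∘ degree≤n∸2 z≢v)

module UniversalVertex (G : Graph n) (v : Fin n) (universal : ∀ {z} → z ≢ v → Edge G v z) where
  open Graph G

  dist : Fin n → Fin n → ℕ
  dist x y with x ≟ y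
  ... | yes _ = 0
  ... | no _ = if adj x y then 1 else 2

  dist-≢ : ∀ {x y} → x ≢ y → dist x y ≡ (if adj x y then 1 else 2)
  dist-≢ {x} {y} x≢y with x ≟ y
  ... | yes x≡y = contradiction x≡y x≢y
  ... | no _ = refl

  dist-Edge : ∀ {x y} → Edge G x y → dist x y ≡ 1
  dist-Edge {x} {y} xy = trans (dist-≢ (Edge⇒≢ G xy)) (cong (if_then 1 else 2) xy)

  dist-¬Edge : ∀ {x y} → x ≢ y → ¬ Edge G x y → dist x y ≡ 2
  dist-¬Edge {x} {y} x≢y ¬xy = trans (dist-≢ x≢y) (cong (if_then 1 else 2) (¬-not ¬xy))

  dist≡1⇒Edge : ∀ {x y} → dist x y ≡ 1 → Edge G x y
  dist≡1⇒Edge {x} {y} d≡1 with x ≟ y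
  ... | no _ with adj x y
  ...   | true = refl
  dist≡1⇒Edge () | no _ | false
  dist≡1⇒Edge () | yes _

  dist-to-v : ∀ {x} → x ≢ v → dist x v ≡ 1
  dist-to-v = dist-Edge ∘ Edge-sym G ∘ universal

  dist-from-v : ∀ {z} → z ≢ v → dist v z ≡ 1
  dist-from-v = dist-Edge ∘ universal

  ¬Edge⇒≢v : ∀ {x y} → x ≢ y → ¬ Edge G x y → x ≢ v
  ¬Edge⇒≢v x≢y ¬xy refl = ¬xy (universal (x≢y ∘ sym))

  ¬Edge⇒≢vʳ : ∀ {x y} → x ≢ y → ¬ Edge G x y → y ≢ v
  ¬Edge⇒≢vʳ x≢y ¬xy = ¬Edge⇒≢v (x≢y ∘ sym) (¬xy ∘ Edge-sym G)

  Walk-length≥1 : ∀ {x y m} → x ≢ y → Walk G x y m → 1 ≤ m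
  Walk-length≥1 x≢y nil = contradiction refl x≢y
  Walk-length≥1 x≢y (cons _ _) = s≤s z≤n

  Walk-length≥2 : ∀ {x y m} → x ≢ y → ¬ Edge G x y → Walk G x y m → 2 ≤ m
  Walk-length≥2 x≢y ¬xy nil = contradiction refl x≢y
  Walk-length≥2 x≢y ¬xy (cons xy nil) = contradiction xy ¬xy
  Walk-length≥2 x≢y ¬xy (cons _ (cons _ _)) = s≤s (s≤s z≤n)

  dist-isDist : ∀ x y → Dist G x y (dist x y)
  dist-isDist x y with x ≟ y
  ... | yes refl = nil , λ _ _ → z≤n
  ... | no x≢y with adj x y in xy
  ...   | true = cons xy nil , λ _ → Walk-length≥1 x≢y
  ...   | false = cons (Edge-sym G (universal x≢v)) (cons (universal y≢v) nil) , λ _ → Walk-length≥2 x≢y ¬xy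
    where
    ¬xy : ¬ Edge G x y
    ¬xy e with () ← trans (sym e) xy
    x≢v = ¬Edge⇒≢v x≢y ¬xy
    y≢v = ¬Edge⇒≢vʳ x≢y ¬xy

  Dist⇒≡dist : ∀ {x y m} → Dist G x y m → m ≡ dist x y
  Dist⇒≡dist {x} {y} (walk , minimal) =
    ≤-antisym (minimal _ (proj₁ (dist-isDist x y))) (proj₂ (dist-isDist x y) _ walk)

  record SameRep (W : Subset n) (x y : Fin n) : Set where
    constructor sameRep
    field dist≡ : ∀ {w} → w ∈ W → dist x w ≡ dist y w
  open SameRep

  SameRep? : ∀ W x y → Dec (SameRep W x y)
  SameRep? W x y with all? (λ w → w ∈? W →-dec dist x w ≟ℕ dist y w)
  ... | yes same = yes (sameRep (same _))
  ... | no ¬same = no λ same → ¬same (λ _ → dist≡ same)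

  resolves : ∀ {W x y} → Resolving G W → SameRep W x y → x ≡ y
  resolves {x = x} {y} resolving same =
    resolving x y λ w w∈W _ _ dx dy → trans (Dist⇒≡dist dx) (trans (dist≡ same w∈W) (sym (Dist⇒≡dist dy)))

  resolving : ∀ {W} → (∀ x y → SameRep W x y → x ≡ y) → Resolving G W
  resolving separates x y sameDist =
    separates x y (sameRep λ {w} w∈W → sameDist w w∈W _ _ (dist-isDist x w) (dist-isDist y w))

  ¬Resolving⇒∃SameRep : ∀ {W} → ¬ Resolving G W → ∃₂ λ x y → x ≢ y × SameRep W x y
  ¬Resolving⇒∃SameRep {W} ¬resolving
    with ¬∀₂⟶∃₂¬ (λ x y → SameRep W x y → x ≡ y) (λ x y → SameRep? W x y →-dec x ≟ y) (¬resolving ∘ resolving)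
  ... | x , y , ¬[same→≡] = x , y , ¬[same→≡] ∘ (λ x≡y _ → x≡y) , same
    where
    same : SameRep W x y
    same = decidable-stable (SameRep? W x y) λ ¬same → ¬[same→≡] λ same → contradiction same ¬same

  SameRep-⁅v⁆ : ∀ {x y} → x ≢ v → y ≢ v → SameRep ⁅ v ⁆ x y
  SameRep-⁅v⁆ {x} {y} x≢v y≢v = sameRep λ w∈⁅v⁆ → subst (λ w → dist x w ≡ dist y w) (sym (x∈⁅y⁆⇒x≡y v w∈⁅v⁆))
                                                         (trans (dist-to-v x≢v) (sym (dist-to-v y≢v)))

  SameRep-sym : ∀ {W x y} → SameRep W x y → SameRep W y x
  SameRep-sym same = sameRep (sym ∘ dist≡ same)

  SameRep-∪⁅⁆ : ∀ {W x y z} → SameRep W x y → dist x z ≡ dist y z → SameRep (W ∪ ⁅ z ⁆) x y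
  SameRep-∪⁅⁆ {W} {x} {y} {z} same same-z = sameRep dist≡′
    where
    dist≡′ : ∀ {w} → w ∈ W ∪ ⁅ z ⁆ → dist x w ≡ dist y w
    dist≡′ w∈ with x∈p∪⁅y⁆⁻ w∈
    ... | inj₁ w∈W = dist≡ same w∈W
    ... | inj₂ refl = same-z

  record HasNeighbourhood (u : Fin n) (T : Subset n) : Set where
    field
      u≢v : u ≢ v
      ∈⇒Edge : ∀ {z} → z ∈ T → Edge G u z
      Edge⇒∈ : ∀ {z} → z ≢ v → Edge G u z → z ∈ T

    u∉T : u ∉ T
    u∉T u∈T = Edge⇒≢ G (∈⇒Edge u∈T) refl

  module RandomlyDimensional (k : ℕ)
    (k-sets-resolve : ∀ W → ∣ W ∣ ≡ k → Resolving G W)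
    (resolving⇒k≤ : ∀ W → Resolving G W → k ≤ ∣ W ∣) where

    ∃SameRep : ∀ {T} → suc ∣ T ∣ ≡ k → ∃₂ λ x y → x ≢ y × SameRep T x y
    ∃SameRep {T} size = ¬Resolving⇒∃SameRep λ T-resolves →
      1+n≰n (subst (_≤ ∣ T ∣) (sym size) (resolving⇒k≤ T T-resolves))

    separated-outside : ∀ {T x y z} → suc ∣ T ∣ ≡ k → x ≢ y → SameRep T x y → z ∉ T → dist x z ≢ dist y z
    separated-outside {T} {z = z} size x≢y same z∉T same-z =
      x≢y (resolves (k-sets-resolve (T ∪ ⁅ z ⁆) (trans (x∉p⇒∣p∪⁅x⁆∣≡suc∣p∣ z∉T) size)) (SameRep-∪⁅⁆ same same-z))

    -- v and u are separated exactly by the vertices outside T, i.e. by the non-neighbours of u.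
    SameRep-v⇒HasNeighbourhood : ∀ {T u} → suc ∣ T ∣ ≡ k → v ∉ T → SameRep T v u → v ≢ u → HasNeighbourhood u T
    SameRep-v⇒HasNeighbourhood {T} size v∉T same v≢u = record
      { u≢v = v≢u ∘ sym
      ; ∈⇒Edge = λ z∈T → dist≡1⇒Edge (trans (sym (dist≡ same z∈T)) (dist-from-v λ { refl → v∉T z∈T }))
      ; Edge⇒∈ = λ {z} z≢v uz → decidable-stable (z ∈? T) λ z∉T →
          separated-outside size v≢u same z∉T (trans (dist-from-v z≢v) (sym (dist-Edge uz)))
      }

    neighbourhood-realised : ∀ {T} → suc ∣ T ∣ ≡ k → v ∉ T → ∃ λ u → HasNeighbourhood u T
    neighbourhood-realised {T} size v∉T with ∃SameRep size
    ... | x , y , x≢y , same with x ≟ v | y ≟ v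
    ...   | yes refl | _ = y , SameRep-v⇒HasNeighbourhood size v∉T same x≢y
    ...   | no _ | yes refl = x , SameRep-v⇒HasNeighbourhood size v∉T (SameRep-sym same) (x≢y ∘ sym)
    ...   | no x≢v | no y≢v =
      contradiction (trans (dist-to-v x≢v) (sym (dist-to-v y≢v))) (separated-outside size x≢y same v∉T)

    -- The realiser of T - t ∪ {u} is adjacent to u, hence lies in T, and it cannot lie in T - t.
    neighbourhood-exchange : ∀ {T u t} → suc ∣ T ∣ ≡ k → v ∉ T → HasNeighbourhood u T → t ∈ T →
                             HasNeighbourhood t ((T - t) ∪ ⁅ u ⁆)
    neighbourhood-exchange {T} {u} {t} size v∉T N t∈T with neighbourhood-realised size′ v∉T′
      where
      open HasNeighbourhood N
      size′ : suc ∣ (T - t) ∪ ⁅ u ⁆ ∣ ≡ k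
      size′ = trans (cong suc (trans (x∉p⇒∣p∪⁅x⁆∣≡suc∣p∣ (u∉T ∘ x∈p-y⇒x∈p)) (x∈p⇒suc∣p-x∣≡∣p∣ T t∈T))) size
      v∉T′ : v ∉ (T - t) ∪ ⁅ u ⁆
      v∉T′ = x∉p∧x≢y⇒x∉p∪⁅y⁆ (x∉p⇒x∉p-y v∉T) (u≢v ∘ sym)
    ... | u′ , N′ = subst (λ w → HasNeighbourhood w ((T - t) ∪ ⁅ u ⁆)) u′≡t N′
      where
      open HasNeighbourhood
      u′∈T : u′ ∈ T
      u′∈T = Edge⇒∈ N (u≢v N′) (Edge-sym G (∈⇒Edge N′ (y∈p∪⁅y⁆ u)))
      u′≡t : u′ ≡ t
      u′≡t = decidable-stable (u′ ≟ t) λ u′≢t → u∉T N′ (x∈p⇒x∈p∪⁅y⁆ (x∈p∧x≢y⇒x∈p-y u′∈T u′≢t))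

    T∪⁅u⁆-clique : ∀ {T u} → suc ∣ T ∣ ≡ k → v ∉ T → HasNeighbourhood u T →
                   ∀ {x y} → x ∈ T ∪ ⁅ u ⁆ → y ∈ T ∪ ⁅ u ⁆ → x ≢ y → Edge G x y
    T∪⁅u⁆-clique size v∉T N x∈ y∈ x≢y with x∈p∪⁅y⁆⁻ x∈ | x∈p∪⁅y⁆⁻ y∈
    ... | inj₁ x∈T | inj₁ y∈T = HasNeighbourhood.∈⇒Edge (neighbourhood-exchange size v∉T N x∈T)
                                  (x∈p⇒x∈p∪⁅y⁆ (x∈p∧x≢y⇒x∈p-y y∈T (x≢y ∘ sym)))
    ... | inj₁ x∈T | inj₂ refl = HasNeighbourhood.∈⇒Edge (neighbourhood-exchange size v∉T N x∈T) (y∈p∪⁅y⁆ _)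
    ... | inj₂ refl | inj₁ y∈T = HasNeighbourhood.∈⇒Edge N y∈T
    ... | inj₂ refl | inj₂ refl = contradiction refl x≢y

    -- W = T - t ∪ {v, b} has size k but does not separate t ∈ T from u.
    no-vertex-outside : ∀ {T u t b} → suc ∣ T ∣ ≡ k → v ∉ T → HasNeighbourhood u T → t ∈ T →
                        b ≢ v → b ∉ T ∪ ⁅ u ⁆ → ⊥₀
    no-vertex-outside {T} {u} {t} {b} size v∉T N t∈T b≢v b∉ =
      HasNeighbourhood.u∉T N (subst (_∈ T) (resolves (k-sets-resolve W size-W) same) t∈T)
      where
      open HasNeighbourhood N
      Nt : HasNeighbourhood t ((T - t) ∪ ⁅ u ⁆)
      Nt = neighbourhood-exchange size v∉T N t∈T
      W : Subset n
      W = ((T - t) ∪ ⁅ v ⁆) ∪ ⁅ b ⁆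
      b∉T : b ∉ T
      b∉T = b∉ ∘ x∈p⇒x∈p∪⁅y⁆
      b≢u : b ≢ u
      b≢u = x∉p∪⁅y⁆⇒x≢y b∉
      t≢v : t ≢ v
      t≢v refl = v∉T t∈T
      t≢b : t ≢ b
      t≢b refl = b∉T t∈T
      size-W : ∣ W ∣ ≡ k
      size-W = begin
        ∣ W ∣                    ≡⟨ x∉p⇒∣p∪⁅x⁆∣≡suc∣p∣ (x∉p∧x≢y⇒x∉p∪⁅y⁆ (x∉p⇒x∉p-y b∉T) b≢v) ⟩
        suc ∣ (T - t) ∪ ⁅ v ⁆ ∣  ≡⟨ cong suc (x∉p⇒∣p∪⁅x⁆∣≡suc∣p∣ (x∉p⇒x∉p-y v∉T)) ⟩
        suc (suc ∣ T - t ∣)      ≡⟨ cong suc (x∈p⇒suc∣p-x∣≡∣p∣ T t∈T) ⟩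
        suc ∣ T ∣                ≡⟨ size ⟩
        k                        ∎
        where open ≡-Reasoning
      same-T-t : ∀ {w} → w ∈ T - t → dist t w ≡ dist u w
      same-T-t w∈ = trans (dist-Edge (HasNeighbourhood.∈⇒Edge Nt (x∈p⇒x∈p∪⁅y⁆ w∈)))
                          (sym (dist-Edge (∈⇒Edge (x∈p-y⇒x∈p w∈))))
      same-v : dist t v ≡ dist u v
      same-v = trans (dist-to-v t≢v) (sym (dist-to-v u≢v))
      same-b : dist t b ≡ dist u b
      same-b = trans (dist-¬Edge t≢b ¬tb) (sym (dist-¬Edge (b≢u ∘ sym) ¬ub))
        where
        ¬tb : ¬ Edge G t b
        ¬tb = x∉p∧x≢y⇒x∉p∪⁅y⁆ (x∉p⇒x∉p-y b∉T) b≢u ∘ HasNeighbourhood.Edge⇒∈ Nt b≢v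
        ¬ub : ¬ Edge G u b
        ¬ub = b∉T ∘ Edge⇒∈ b≢v
      same : SameRep W t u
      same = SameRep-∪⁅⁆ (SameRep-∪⁅⁆ (sameRep same-T-t) same-v) same-b

    no-non-edge-when-k≥2 : ∀ {T} → suc ∣ T ∣ ≡ k → v ∉ T → Nonempty T → ∀ {x y} → x ≢ y → ¬ Edge G x y → ⊥₀
    no-non-edge-when-k≥2 {T} size v∉T (t , t∈T) {x} {y} x≢y ¬xy with neighbourhood-realised size v∉T
    ... | u , N with x ∈? T ∪ ⁅ u ⁆ | y ∈? T ∪ ⁅ u ⁆
    ... | yes x∈ | yes y∈ = ¬xy (T∪⁅u⁆-clique size v∉T N x∈ y∈ x≢y)
    ... | no x∉ | _ = no-vertex-outside size v∉T N t∈T (¬Edge⇒≢v x≢y ¬xy) x∉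
    ... | _ | no y∉ = no-vertex-outside size v∉T N t∈T (¬Edge⇒≢vʳ x≢y ¬xy) y∉

    no-non-edge : ∀ B → ∣ B ∣ ≡ k → ∀ {x y} → x ≢ y → ¬ Edge G x y → ⊥₀
    no-non-edge B ∣B∣≡k {x} {y} x≢y ¬xy = by-size k refl
      where
      by-size : ∀ k′ → k ≡ k′ → ⊥₀
      by-size zero k≡0 =
        x≢y (resolves (k-sets-resolve ⊥ (trans (∣⊥∣≡0 n) (sym k≡0))) (sameRep λ w∈⊥ → contradiction w∈⊥ ∉⊥))
      by-size (suc zero) k≡1 =
        x≢y (resolves (k-sets-resolve ⁅ v ⁆ (trans (∣⁅x⁆∣≡1 v) (sym k≡1)))
                      (SameRep-⁅v⁆ (¬Edge⇒≢v x≢y ¬xy) (¬Edge⇒≢vʳ x≢y ¬xy)))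
      by-size (suc (suc _)) k≡2+ with ∃p-x∌y B v (trans ∣B∣≡k k≡2+)
      ... | T , T+1≡B , v∉T = no-non-edge-when-k≥2 (trans T+1≡B ∣B∣≡k) v∉T
                                (∣p∣≡suc⇒Nonempty (suc-injective (trans T+1≡B (trans ∣B∣≡k k≡2+)))) x≢y ¬xy

mainTheorem11 : (n k : ℕ) (G : Graph n) → Connected G → RandomlyDim G k →
    ¬ Complete G → MaxDegree≤ G (n ∸ 2)
mainTheorem11 n k G _ (((B , _ , ∣B∣≡k) , minimal) , random) ¬complete v =
  decidable-stable (degree G v ≤? n ∸ 2) λ deg≰ →
    let x , y , x≢y , ¬xy = ∃non-edge G ¬complete
        open UniversalVertex G v (¬degree≤n∸2⇒universal G deg≰)
        open RandomlyDimensional k (λ W → proj₁ ∘ random W) minimal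
    in no-non-edge B ∣B∣≡k x≢y ¬xy
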